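{- If $n\in O_{\mathrm{FS}}$, then $n$ has at most two distinct prime divisors.
   Context: $O_{\mathrm{FS}}$ is the set of odd integers $n\ge1$ such that for every $x\in\mathbb Z$ coprime to $n$ there exists $j\ge0$ with $n\mid x-2^j$ or $n\mid x+2^j$. -}

module Defs where

open import Data.Nat.Base using (ℕ; _≥_; _^_)
open import Data.Nat.Primality using (Prime)
open import Data.Nat.Coprimality using (Coprime)
open import Data.Nat.Divisibility using (_∣_)
open import Data.Integer.Base as ℤ using (ℤ; +_; ∣_∣)
import Data.Integer.Divisibility as ℤd
open import Data.Product using (_×_; ∃)
open import Data.Sum using (_⊎_)
open import Relation.Binary.PropositionalEquality using (_≡_)
open import Relation.Nullary using (¬_)

Odd : ℕ → Set
Odd n = ¬ (2 ∣ n)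

InOFS : ℕ → Set
InOFS n =
  Odd n × n ≥ 1 ×
  ((x : ℤ) → Coprime ∣ x ∣ n →
     ∃ λ (j : ℕ) → ((+ n) ℤd.∣ (x ℤ.- (+ (2 ^ j)))) ⊎ ((+ n) ℤd.∣ (x ℤ.+ (+ (2 ^ j)))))

AtMostTwoPrimeDivisors : ℕ → Set
AtMostTwoPrimeDivisors n =
  ∀ p q r → Prime p → Prime q → Prime r → p ∣ n → q ∣ n → r ∣ n →
  (p ≡ q) ⊎ (p ≡ r) ⊎ (q ≡ r)

-- Suppose distinct primes p, q, r divide n. By the Chinese remainder theorem there are
-- square roots u, v of 1 mod n with u ≡ -1 on the p-primary part of n and ≡ 1 on the rest,
-- and v likewise for q. Since n is odd, u, v and uv are all ≢ ±1 mod n (uv ≡ -1 mod p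
-- but ≡ 1 mod r). The hypothesis writes u ≡ ±2^a and v ≡ ±2^b; but the cyclic group
-- generated by 2 mod n has at most one element of order 2, so 2^a ≡ 2^b and
-- uv ≡ ±2^(2a) ≡ ±1, a contradiction.
module Submission where

open import Defs
open import Data.Empty using (⊥; ⊥-elim)
open import Data.Integer.Base using (ℤ; +_; -_; _+_; _-_; _*_; _^_; ∣_∣; 1ℤ; -1ℤ)
import Data.Integer.Divisibility.Signed as ℤ∣
open ℤ∣ using (∣ᵤ⇒∣; ∣⇒∣ᵤ; ∣m∣n⇒∣m+n; ∣m⇒∣m*n; ∣n⇒∣m*n; ∣m⇒∣-m; ∣m+n∣m⇒∣n)
import Data.Integer.Properties as ℤₚ
open import Data.Integer.Tactic.RingSolver using (solve-∀)
open import Data.Nat.Base as ℕ using (ℕ; zero; suc; NonZero)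
open import Data.Nat.Coprimality using (Coprime; coprime-Bézout; coprime-divisor)
open import Data.Nat.Divisibility using (_∣_; _∣?_; divides; ∣-refl; ∣-trans; ∣1⇒≡1)
open import Data.Nat.GCD using (module Bézout)
open import Data.Nat.Induction using (<-wellFounded)
open import Data.Nat.Primality using (Prime; prime⇒irreducible; prime⇒nonTrivial; euclidsLemma; prime[2])
import Data.Nat.Properties as ℕₚ
open import Data.Product using (∃; ∃₂; _×_; _,_)
open import Data.Sum using (_⊎_; inj₁; inj₂)
open import Function using (_∘_)
open import Induction.WellFounded using (Acc; acc)
open import Relation.Binary.Bundles using (Setoid)
open import Relation.Binary.PropositionalEquality as ≡ using (_≡_; _≢_; refl; cong; cong₂)
import Relation.Binary.Reasoning.Setoid as SetoidReasoning
open import Relation.Nullary using (¬_; Dec; yes; no)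
import Relation.Nullary.Decidable as Dec

infix 4 _≡_mod_ _≡?_mod_

record _≡_mod_ (x y : ℤ) (m : ℕ) : Set where
  constructor ∣⇒≡mod
  field ≡mod⇒∣ : + m ℤ∣.∣ x - y
open _≡_mod_

module _ {m : ℕ} where

  mod-reflexive : ∀ {x y} → x ≡ y → x ≡ y mod m
  mod-reflexive {x} refl = ∣⇒≡mod (ℤ∣.divides (+ 0) (≡.trans (ℤₚ.+-inverseʳ x) (≡.sym (ℤₚ.*-zeroˡ (+ m)))))

  mod-refl : ∀ {x} → x ≡ x mod m
  mod-refl = mod-reflexive refl

  mod-sym : ∀ {x y} → x ≡ y mod m → y ≡ x mod m
  mod-sym {x} {y} (∣⇒≡mod m∣x-y) = ∣⇒≡mod (≡.subst (+ m ℤ∣.∣_) (lemma x y) (∣m⇒∣-m m∣x-y))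
    where
    lemma : ∀ x y → - (x - y) ≡ y - x
    lemma = solve-∀

  mod-trans : ∀ {x y z} → x ≡ y mod m → y ≡ z mod m → x ≡ z mod m
  mod-trans {x} {y} {z} (∣⇒≡mod m∣x-y) (∣⇒≡mod m∣y-z) =
    ∣⇒≡mod (≡.subst (+ m ℤ∣.∣_) (lemma x y z) (∣m∣n⇒∣m+n m∣x-y m∣y-z))
    where
    lemma : ∀ x y z → (x - y) + (y - z) ≡ x - z
    lemma = solve-∀

  mod-*-cong : ∀ {x x′ y y′} → x ≡ x′ mod m → y ≡ y′ mod m → x * y ≡ x′ * y′ mod m
  mod-*-cong {x} {x′} {y} {y′} (∣⇒≡mod m∣x-x′) (∣⇒≡mod m∣y-y′) =
    ∣⇒≡mod (≡.subst (+ m ℤ∣.∣_) (lemma x x′ y y′) (∣m∣n⇒∣m+n (∣m⇒∣m*n y m∣x-x′) (∣n⇒∣m*n x′ m∣y-y′)))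
    where
    lemma : ∀ x x′ y y′ → (x - x′) * y + x′ * (y - y′) ≡ x * y - x′ * y′
    lemma = solve-∀

  mod-*-congˡ : ∀ x {y y′} → y ≡ y′ mod m → x * y ≡ x * y′ mod m
  mod-*-congˡ x = mod-*-cong (mod-refl {x})

  mod-*-congʳ : ∀ y {x x′} → x ≡ x′ mod m → x * y ≡ x′ * y mod m
  mod-*-congʳ y x≡x′ = mod-*-cong x≡x′ (mod-refl {y})

  mod-neg-cong : ∀ {x y} → x ≡ y mod m → - x ≡ - y mod m
  mod-neg-cong {x} {y} (∣⇒≡mod m∣x-y) = ∣⇒≡mod (≡.subst (+ m ℤ∣.∣_) (lemma x y) (∣m⇒∣-m m∣x-y))
    where
    lemma : ∀ x y → - (x - y) ≡ - x - - y
    lemma = solve-∀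

_≡?_mod_ : ∀ x y m → Dec (x ≡ y mod m)
x ≡? y mod m = Dec.map′ ∣⇒≡mod ≡mod⇒∣ (+ m ℤ∣.∣? (x - y))

mod-setoid : ℕ → Setoid _ _
mod-setoid m = record
  { Carrier = ℤ
  ; _≈_ = λ x y → x ≡ y mod m
  ; isEquivalence = record { refl = mod-refl ; sym = mod-sym ; trans = mod-trans }
  }

infix 4 _≡±_mod_

_≡±_mod_ : ℤ → ℤ → ℕ → Set
x ≡± y mod m = x ≡ y mod m ⊎ x ≡ - y mod m

module _ {m : ℕ} where

  ±-*-cong : ∀ {x x′ y y′} → x ≡± x′ mod m → y ≡± y′ mod m → x * y ≡± x′ * y′ mod m
  ±-*-cong (inj₁ x≡x′) (inj₁ y≡y′) = inj₁ (mod-*-cong x≡x′ y≡y′)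
  ±-*-cong {x′ = x′} {y′ = y′} (inj₁ x≡x′) (inj₂ y≡-y′) =
    inj₂ (mod-trans (mod-*-cong x≡x′ y≡-y′) (mod-reflexive (≡.sym (ℤₚ.neg-distribʳ-* x′ y′))))
  ±-*-cong {x′ = x′} {y′ = y′} (inj₂ x≡-x′) (inj₁ y≡y′) =
    inj₂ (mod-trans (mod-*-cong x≡-x′ y≡y′) (mod-reflexive (≡.sym (ℤₚ.neg-distribˡ-* x′ y′))))
  ±-*-cong {x′ = x′} {y′ = y′} (inj₂ x≡-x′) (inj₂ y≡-y′) =
    inj₁ (mod-trans (mod-*-cong x≡-x′ y≡-y′) (mod-reflexive (neg-*-neg x′ y′)))
    where
    neg-*-neg : ∀ x y → - x * - y ≡ x * y
    neg-*-neg = solve-∀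

  ±-square : ∀ {x y} → x ≡± y mod m → x * x ≡ y * y mod m
  ±-square (inj₁ x≡y) = mod-*-cong x≡y x≡y
  ±-square {y = y} (inj₂ x≡-y) = mod-trans (mod-*-cong x≡-y x≡-y) (mod-reflexive (neg-square y))
    where
    neg-square : ∀ y → - y * - y ≡ y * y
    neg-square = solve-∀

  ±-trans : ∀ {x y z} → x ≡± y mod m → y ≡ z mod m → x ≡± z mod m
  ±-trans (inj₁ x≡y) y≡z = inj₁ (mod-trans x≡y y≡z)
  ±-trans (inj₂ x≡-y) y≡z = inj₂ (mod-trans x≡-y (mod-neg-cong y≡z))

NontrivialSqrt1 : ℕ → ℤ → Set
NontrivialSqrt1 m x = x * x ≡ 1ℤ mod m × ¬ x ≡± 1ℤ mod m

module _ {m : ℕ} (g : ℤ) where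
  open SetoidReasoning (mod-setoid m)

  -- Descent on a + b: for a ≤ b write b = a + c. Either g^c ≡ 1, so g^b ≡ g^a; or g^c is
  -- another nontrivial square root of 1 with a smaller pair (a, c), whence g^a ≡ g^c and
  -- g^b ≡ g^a * g^a ≡ 1, which is excluded.
  ^-nontrivial-sqrt1-unique : ∀ a b → g ^ a * g ^ a ≡ 1ℤ mod m → g ^ b * g ^ b ≡ 1ℤ mod m →
    ¬ g ^ a ≡ 1ℤ mod m → ¬ g ^ b ≡ 1ℤ mod m → g ^ a ≡ g ^ b mod m
  ^-nontrivial-sqrt1-unique a b = descend a b (<-wellFounded (a ℕ.+ b))
    where
    Claim : ℕ → ℕ → Set
    Claim a b = g ^ a * g ^ a ≡ 1ℤ mod m → g ^ b * g ^ b ≡ 1ℤ mod m →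
                ¬ g ^ a ≡ 1ℤ mod m → ¬ g ^ b ≡ 1ℤ mod m → g ^ a ≡ g ^ b mod m

    interchange : ∀ x y → (x * x) * (y * y) ≡ (x * y) * (x * y)
    interchange = solve-∀

    ordered : ∀ {a b} → a ℕ.≤ b → (∀ a′ b′ → a′ ℕ.+ b′ ℕ.< a ℕ.+ b → Claim a′ b′) → Claim a b
    ordered {a} a≤b ih gᵃ-sqrt1 gᵇ-sqrt1 gᵃ≢1 gᵇ≢1 with ℕₚ.m≤n⇒∃[o]m+o≡n a≤b
    ... | c , refl with g ^ c ≡? 1ℤ mod m
    ...   | yes gᶜ≡1 = mod-sym (begin
      g ^ (a ℕ.+ c)   ≡⟨ ℤₚ.^-distribˡ-+-* g a c ⟩
      g ^ a * g ^ c   ≈⟨ mod-*-congˡ (g ^ a) gᶜ≡1 ⟩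
      g ^ a * 1ℤ      ≡⟨ ℤₚ.*-identityʳ (g ^ a) ⟩
      g ^ a           ∎)
    ...   | no gᶜ≢1 = ⊥-elim (gᵇ≢1 (begin
      g ^ (a ℕ.+ c)   ≡⟨ ℤₚ.^-distribˡ-+-* g a c ⟩
      g ^ a * g ^ c   ≈⟨ mod-*-congˡ (g ^ a) (mod-sym gᵃ≡gᶜ) ⟩
      g ^ a * g ^ a   ≈⟨ gᵃ-sqrt1 ⟩
      1ℤ              ∎))
      where
      0<a : 0 ℕ.< a
      0<a = ℕₚ.n≢0⇒n>0 λ { refl → gᵃ≢1 mod-refl }
      gᶜ-sqrt1 : g ^ c * g ^ c ≡ 1ℤ mod m
      gᶜ-sqrt1 = begin
        g ^ c * g ^ c                     ≡⟨ ℤₚ.*-identityˡ (g ^ c * g ^ c) ⟨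
        1ℤ * (g ^ c * g ^ c)              ≈⟨ mod-*-congʳ (g ^ c * g ^ c) (mod-sym gᵃ-sqrt1) ⟩
        (g ^ a * g ^ a) * (g ^ c * g ^ c) ≡⟨ interchange (g ^ a) (g ^ c) ⟩
        (g ^ a * g ^ c) * (g ^ a * g ^ c) ≡⟨ cong₂ _*_ (ℤₚ.^-distribˡ-+-* g a c) (ℤₚ.^-distribˡ-+-* g a c) ⟨
        g ^ (a ℕ.+ c) * g ^ (a ℕ.+ c)     ≈⟨ gᵇ-sqrt1 ⟩
        1ℤ                                ∎
      gᵃ≡gᶜ : g ^ a ≡ g ^ c mod m
      gᵃ≡gᶜ = ih a c (ℕₚ.+-monoʳ-< a (ℕₚ.m<n+m c 0<a)) gᵃ-sqrt1 gᶜ-sqrt1 gᵃ≢1 gᶜ≢1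

    descend : ∀ a b → Acc ℕ._<_ (a ℕ.+ b) → Claim a b
    descend a b (acc rec) with ℕₚ.≤-total a b
    ... | inj₁ a≤b = ordered a≤b (λ a′ b′ lt → descend a′ b′ (rec lt))
    ... | inj₂ b≤a = λ gᵃ-sqrt1 gᵇ-sqrt1 gᵃ≢1 gᵇ≢1 →
      mod-sym (ordered b≤a (λ a′ b′ lt → descend a′ b′ (rec (≡.subst (a′ ℕ.+ b′ ℕ.<_) (ℕₚ.+-comm b a) lt)))
                       gᵇ-sqrt1 gᵃ-sqrt1 gᵇ≢1 gᵃ≢1)

  ±powers-nontrivial-sqrt1⇒*≡±1 : ∀ {x y a b} → NontrivialSqrt1 m x → NontrivialSqrt1 m y →
    x ≡± g ^ a mod m → y ≡± g ^ b mod m → x * y ≡± 1ℤ mod m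
  ±powers-nontrivial-sqrt1⇒*≡±1 {a = a} {b} (x-sqrt1 , x≢±1) (y-sqrt1 , y≢±1) x≡±gᵃ y≡±gᵇ =
    ±-trans (±-*-cong x≡±gᵃ y≡±gᵇ) (begin
      g ^ a * g ^ b  ≈⟨ mod-*-congˡ (g ^ a) (mod-sym gᵃ≡gᵇ) ⟩
      g ^ a * g ^ a  ≈⟨ gᵃ-sqrt1 ⟩
      1ℤ             ∎)
    where
    gᵃ-sqrt1 : g ^ a * g ^ a ≡ 1ℤ mod m
    gᵃ-sqrt1 = mod-trans (mod-sym (±-square x≡±gᵃ)) x-sqrt1
    gᵇ-sqrt1 : g ^ b * g ^ b ≡ 1ℤ mod m
    gᵇ-sqrt1 = mod-trans (mod-sym (±-square y≡±gᵇ)) y-sqrt1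
    gᵃ≡gᵇ : g ^ a ≡ g ^ b mod m
    gᵃ≡gᵇ = ^-nontrivial-sqrt1-unique a b gᵃ-sqrt1 gᵇ-sqrt1
              (λ gᵃ≡1 → x≢±1 (±-trans x≡±gᵃ gᵃ≡1)) (λ gᵇ≡1 → y≢±1 (±-trans y≡±gᵇ gᵇ≡1))

≡mod-divisor : ∀ {d m x y} → d ∣ m → x ≡ y mod m → x ≡ y mod d
≡mod-divisor d∣m (∣⇒≡mod m∣x-y) = ∣⇒≡mod (ℤ∣.∣-trans (∣ᵤ⇒∣ d∣m) m∣x-y)

1≡-1mod⇒∣2 : ∀ {d} → 1ℤ ≡ -1ℤ mod d → d ∣ 2
1≡-1mod⇒∣2 (∣⇒≡mod d∣2) = ∣⇒∣ᵤ d∣2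

sqrt1⇒coprime : ∀ {m x} → x * x ≡ 1ℤ mod m → Coprime ∣ x ∣ m
sqrt1⇒coprime {x = x} (∣⇒≡mod m∣x²-1) (d∣x , d∣m) = ∣1⇒≡1 (∣⇒∣ᵤ d∣-1)
  where
  d∣-1 : + _ ℤ∣.∣ -1ℤ
  d∣-1 = ∣m+n∣m⇒∣n (ℤ∣.∣-trans (∣ᵤ⇒∣ d∣m) m∣x²-1) (∣m⇒∣m*n x (∣ᵤ⇒∣ {i = x} d∣x))

pos-^ : ∀ m j → + (m ℕ.^ j) ≡ (+ m) ^ j
pos-^ m zero    = refl
pos-^ m (suc j) = ≡.trans (ℤₚ.pos-* m (m ℕ.^ j)) (cong ((+ m) *_) (pos-^ m j))

pos-[1+m*n≡o*p] : ∀ m n o p → 1 ℕ.+ m ℕ.* n ≡ o ℕ.* p → 1ℤ + (+ m) * (+ n) ≡ (+ o) * (+ p)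
pos-[1+m*n≡o*p] m n o p eq = begin
  1ℤ + (+ m) * (+ n)   ≡⟨ cong (λ t → 1ℤ + t) (ℤₚ.pos-* m n) ⟨
  1ℤ + + (m ℕ.* n)     ≡⟨ ℤₚ.pos-+ 1 (m ℕ.* n) ⟨
  + (1 ℕ.+ m ℕ.* n)    ≡⟨ cong +_ eq ⟩
  + (o ℕ.* p)          ≡⟨ ℤₚ.pos-* o p ⟩
  (+ o) * (+ p)        ∎
  where open ≡.≡-Reasoning

coprime⇒ℤ-Bézout : ∀ {A M} → Coprime A M → ∃₂ λ α β → α * + A + β * + M ≡ 1ℤ
coprime⇒ℤ-Bézout {A} {M} c with coprime-Bézout c
... | Bézout.+- x y 1+yM≡xA = + x , - (+ y) , (begin
  (+ x) * (+ A) + - (+ y) * (+ M)         ≡⟨ cong (_+ - (+ y) * (+ M)) (pos-[1+m*n≡o*p] y M x A 1+yM≡xA) ⟨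
  (1ℤ + (+ y) * (+ M)) + - (+ y) * (+ M)  ≡⟨ cancel (+ y) (+ M) ⟩
  1ℤ                                      ∎)
  where
  open ≡.≡-Reasoning
  cancel : ∀ y M → (1ℤ + y * M) + - y * M ≡ 1ℤ
  cancel = solve-∀
... | Bézout.-+ x y 1+xA≡yM = - (+ x) , + y , (begin
  - (+ x) * (+ A) + (+ y) * (+ M)         ≡⟨ cong (λ t → - (+ x) * (+ A) + t) (pos-[1+m*n≡o*p] x A y M 1+xA≡yM) ⟨
  - (+ x) * (+ A) + (1ℤ + (+ x) * (+ A))  ≡⟨ cancel (+ x) (+ A) ⟩
  1ℤ                                      ∎)
  where
  open ≡.≡-Reasoning
  cancel : ∀ x A → - x * A + (1ℤ + x * A) ≡ 1ℤ
  cancel = solve-∀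

chinese-remainder : ∀ {A M} → Coprime A M → ∀ a b → ∃ λ u → u ≡ a mod A × u ≡ b mod M
chinese-remainder {A} {M} c a b with coprime⇒ℤ-Bézout c
... | α , β , bézout = u , ∣⇒≡mod (ℤ∣.divides ((b - a) * α) u-a≡) , ∣⇒≡mod (ℤ∣.divides ((a - b) * β) u-b≡)
  where
  open ≡.≡-Reasoning
  u : ℤ
  u = a * (β * + M) + b * (α * + A)
  via-bézout : ∀ t → u - t ≡ u - t * (α * + A + β * + M)
  via-bézout t = cong (λ s → u - s) (≡.trans (≡.sym (ℤₚ.*-identityʳ t)) (cong (t *_) (≡.sym bézout)))
  identityᵃ : ∀ a b α β A M → (a * (β * M) + b * (α * A)) - a * (α * A + β * M) ≡ ((b - a) * α) * A
  identityᵃ = solve-∀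
  identityᵇ : ∀ a b α β A M → (a * (β * M) + b * (α * A)) - b * (α * A + β * M) ≡ ((a - b) * β) * M
  identityᵇ = solve-∀
  u-a≡ : u - a ≡ ((b - a) * α) * + A
  u-a≡ = ≡.trans (via-bézout a) (identityᵃ a b α β (+ A) (+ M))
  u-b≡ : u - b ≡ ((a - b) * β) * + M
  u-b≡ = ≡.trans (via-bézout b) (identityᵇ a b α β (+ A) (+ M))

≡-1∧≡1⇒sqrt1 : ∀ {A M u} → u ≡ -1ℤ mod A → u ≡ 1ℤ mod M → u * u ≡ 1ℤ mod (A ℕ.* M)
≡-1∧≡1⇒sqrt1 {A} {M} {u} (∣⇒≡mod (ℤ∣.divides q u+1≡qA)) (∣⇒≡mod (ℤ∣.divides r u-1≡rM)) =
  ∣⇒≡mod (ℤ∣.divides (q * r) (begin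
    u * u - 1ℤ                ≡⟨ factor u ⟩
    (u + 1ℤ) * (u - 1ℤ)       ≡⟨ cong₂ _*_ u+1≡qA u-1≡rM ⟩
    (q * + A) * (r * + M)     ≡⟨ regroup q r (+ A) (+ M) ⟩
    (q * r) * (+ A * + M)     ≡⟨ cong ((q * r) *_) (ℤₚ.pos-* A M) ⟨
    (q * r) * + (A ℕ.* M)     ∎))
  where
  open ≡.≡-Reasoning
  factor : ∀ u → u * u - 1ℤ ≡ (u + 1ℤ) * (u - 1ℤ)
  factor = solve-∀
  regroup : ∀ q r A M → (q * A) * (r * M) ≡ (q * r) * (A * M)
  regroup = solve-∀

prime≢1 : ∀ {p} → Prime p → p ≢ 1
prime≢1 pp = ℕ.nonTrivial⇒≢1 {{prime⇒nonTrivial pp}}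

prime∣prime⇒≡ : ∀ {p q} → Prime p → Prime q → p ∣ q → p ≡ q
prime∣prime⇒≡ pp pq p∣q with prime⇒irreducible pq p∣q
... | inj₁ p≡1 = ⊥-elim (prime≢1 pp p≡1)
... | inj₂ p≡q = p≡q

prime∤⇒coprime-^ : ∀ {p m} → Prime p → ¬ p ∣ m → ∀ k → Coprime (p ℕ.^ k) m
prime∤⇒coprime-^ {p} {m} pp p∤m k {d} (d∣pᵏ , d∣m) = peel k d∣pᵏ
  where
  d-coprime-p : Coprime d p
  d-coprime-p {e} (e∣d , e∣p) with prime⇒irreducible pp e∣p
  ... | inj₁ e≡1 = e≡1
  ... | inj₂ refl = ⊥-elim (p∤m (∣-trans e∣d d∣m))
  peel : ∀ k → d ∣ p ℕ.^ k → d ≡ 1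
  peel zero    d∣1     = ∣1⇒≡1 d∣1
  peel (suc k) d∣p*pᵏ = peel k (coprime-divisor d-coprime-p d∣p*pᵏ)

split-prime-power : ∀ {p} → Prime p → ∀ n → .{{NonZero n}} → ∃₂ λ k m → n ≡ p ℕ.^ k ℕ.* m × ¬ p ∣ m
split-prime-power {p} pp n = split n (<-wellFounded n)
  where
  split : ∀ n → .{{NonZero n}} → Acc ℕ._<_ n → ∃₂ λ k m → n ≡ p ℕ.^ k ℕ.* m × ¬ p ∣ m
  split n (acc rec) with p ∣? n
  ... | no p∤n = 0 , n , ≡.sym (ℕₚ.+-identityʳ n) , p∤n
  ... | yes (divides q refl) with split q {{ℕₚ.m*n≢0⇒m≢0 q}} (rec q<q*p)
    where
    q<q*p : q ℕ.< q ℕ.* p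
    q<q*p = ℕₚ.m<m*n q p {{ℕₚ.m*n≢0⇒m≢0 q}} (ℕ.nonTrivial⇒n>1 p {{prime⇒nonTrivial pp}})
  ... | k , m , q≡pᵏm , p∤m = suc k , m , (begin
    q ℕ.* p              ≡⟨ ℕₚ.*-comm q p ⟩
    p ℕ.* q              ≡⟨ cong (p ℕ.*_) q≡pᵏm ⟩
    p ℕ.* (p ℕ.^ k ℕ.* m) ≡⟨ ℕₚ.*-assoc p (p ℕ.^ k) m ⟨
    p ℕ.^ suc k ℕ.* m     ∎) , p∤m
    where open ≡.≡-Reasoning

∃-sqrt1-≡-1-only-mod : ∀ {n p} → .{{NonZero n}} → Prime p → p ∣ n →
  ∃ λ u → u * u ≡ 1ℤ mod n × u ≡ -1ℤ mod p × (∀ {s} → Prime s → s ∣ n → s ≢ p → u ≡ 1ℤ mod s)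
∃-sqrt1-≡-1-only-mod {n} {p} pp p∣n with split-prime-power pp n
... | k , m , refl , p∤m =
  let u , u≡-1 , u≡1 = chinese-remainder (prime∤⇒coprime-^ pp p∤m k) -1ℤ 1ℤ in
  u , ≡-1∧≡1⇒sqrt1 u≡-1 u≡1 , ≡mod-divisor p∣pᵏ u≡-1 , λ ps s∣n s≢p → ≡mod-divisor (s∣m ps s∣n s≢p) u≡1
  where
  p∣pᵏ : p ∣ p ℕ.^ k
  p∣pᵏ with euclidsLemma (p ℕ.^ k) m pp p∣n
  ... | inj₁ p∣pᵏ = p∣pᵏ
  ... | inj₂ p∣m  = ⊥-elim (p∤m p∣m)
  s∣m : ∀ {s} → Prime s → s ∣ p ℕ.^ k ℕ.* m → s ≢ p → s ∣ m
  s∣m {s} ps s∣n s≢p with euclidsLemma (p ℕ.^ k) m ps s∣n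
  ... | inj₂ s∣m  = s∣m
  ... | inj₁ s∣pᵏ = ⊥-elim (prime≢1 ps (prime∤⇒coprime-^ pp p∤s k (s∣pᵏ , ∣-refl)))
    where
    p∤s : ¬ p ∣ s
    p∤s p∣s = s≢p (≡.sym (prime∣prime⇒≡ pp ps p∣s))

prime∣odd⇒1≢-1 : ∀ {n p} → Odd n → Prime p → p ∣ n → ¬ 1ℤ ≡ -1ℤ mod p
prime∣odd⇒1≢-1 {n} odd pp p∣n 1≡-1 =
  odd (≡.subst (_∣ n) (prime∣prime⇒≡ pp prime[2] (1≡-1mod⇒∣2 1≡-1)) p∣n)

≡-1∧≡1⇒≢±1 : ∀ {n p r x} → Odd n → Prime p → Prime r → p ∣ n → r ∣ n →
  x ≡ -1ℤ mod p → x ≡ 1ℤ mod r → ¬ x ≡± 1ℤ mod n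
≡-1∧≡1⇒≢±1 odd pp pr p∣n r∣n x≡-1 x≡1 (inj₁ x≡1[n]) =
  prime∣odd⇒1≢-1 odd pp p∣n (mod-trans (mod-sym (≡mod-divisor p∣n x≡1[n])) x≡-1)
≡-1∧≡1⇒≢±1 odd pp pr p∣n r∣n x≡-1 x≡1 (inj₂ x≡-1[n]) =
  prime∣odd⇒1≢-1 odd pr r∣n (mod-trans (mod-sym x≡1) (≡mod-divisor r∣n x≡-1[n]))

OFS-sqrt1≡±2^ : ∀ {n x} → InOFS n → x * x ≡ 1ℤ mod n → ∃ λ j → x ≡± (+ 2) ^ j mod n
OFS-sqrt1≡±2^ {n} {x} (_ , _ , ofs) x-sqrt1 with ofs x (sqrt1⇒coprime {x = x} x-sqrt1)
... | j , inj₁ n∣x-2ʲ = j , inj₁ (∣⇒≡mod (≡.subst (λ t → + n ℤ∣.∣ x - t) (pos-^ 2 j) (∣ᵤ⇒∣ n∣x-2ʲ)))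
... | j , inj₂ n∣x+2ʲ = j , inj₂ (∣⇒≡mod (≡.subst (λ t → + n ℤ∣.∣ x + t) 2ʲ≡--2ʲ (∣ᵤ⇒∣ n∣x+2ʲ)))
  where
  2ʲ≡--2ʲ : + (2 ℕ.^ j) ≡ - - (+ 2) ^ j
  2ʲ≡--2ʲ = ≡.trans (pos-^ 2 j) (≡.sym (ℤₚ.neg-involutive ((+ 2) ^ j)))

OFS⇒¬three-distinct-prime-divisors : ∀ {n p q r} → InOFS n → Prime p → Prime q → Prime r →
  p ∣ n → q ∣ n → r ∣ n → p ≢ q → p ≢ r → q ≢ r → ⊥
OFS⇒¬three-distinct-prime-divisors {n} {p} {q} {r} ofs@(odd , n≥1 , _) pp pq pr p∣n q∣n r∣n p≢q p≢r q≢r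
  with ∃-sqrt1-≡-1-only-mod {{ℕ.>-nonZero n≥1}} pp p∣n | ∃-sqrt1-≡-1-only-mod {{ℕ.>-nonZero n≥1}} pq q∣n
... | u , u-sqrt1 , u≡-1[p] , u≡1[s] | v , v-sqrt1 , v≡-1[q] , v≡1[s]
  with OFS-sqrt1≡±2^ ofs u-sqrt1 | OFS-sqrt1≡±2^ ofs v-sqrt1
... | a , u≡±2ᵃ | b , v≡±2ᵇ =
  ≡-1∧≡1⇒≢±1 odd pp pr p∣n r∣n uv≡-1[p] uv≡1[r]
    (±powers-nontrivial-sqrt1⇒*≡±1 (+ 2) {a = a} {b} (u-sqrt1 , u≢±1) (v-sqrt1 , v≢±1) u≡±2ᵃ v≡±2ᵇ)
  where
  u≡1[q] : u ≡ 1ℤ mod q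
  u≡1[q] = u≡1[s] pq q∣n (p≢q ∘ ≡.sym)
  v≡1[p] : v ≡ 1ℤ mod p
  v≡1[p] = v≡1[s] pp p∣n p≢q
  u≢±1 : ¬ u ≡± 1ℤ mod n
  u≢±1 = ≡-1∧≡1⇒≢±1 odd pp pq p∣n q∣n u≡-1[p] u≡1[q]
  v≢±1 : ¬ v ≡± 1ℤ mod n
  v≢±1 = ≡-1∧≡1⇒≢±1 odd pq pp q∣n p∣n v≡-1[q] v≡1[p]
  uv≡-1[p] : u * v ≡ -1ℤ mod p
  uv≡-1[p] = mod-*-cong u≡-1[p] v≡1[p]
  uv≡1[r] : u * v ≡ 1ℤ mod r
  uv≡1[r] = mod-*-cong (u≡1[s] pr r∣n (p≢r ∘ ≡.sym)) (v≡1[s] pr r∣n (q≢r ∘ ≡.sym))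

proposition3p8 : (n : ℕ) → InOFS n → AtMostTwoPrimeDivisors n
proposition3p8 n ofs p q r pp pq pr p∣n q∣n r∣n with p ℕₚ.≟ q | p ℕₚ.≟ r | q ℕₚ.≟ r
... | yes p≡q | _       | _       = inj₁ p≡q
... | no _    | yes p≡r | _       = inj₂ (inj₁ p≡r)
... | no _    | no _    | yes q≡r = inj₂ (inj₂ q≡r)
... | no p≢q  | no p≢r  | no q≢r  =
  ⊥-elim (OFS⇒¬three-distinct-prime-divisors ofs pp pq pr p∣n q∣n r∣n p≢q p≢r q≢r)
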